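{- Let $H$ be a bipartite graph. Then $H$ contains no induced subgraph isomorphic to $K_{3,3}\setminus\{e\}$ or to the domino if and only if for every vertex $v\in V(H)$ and every component $U$ of the split of $B_2(v)$ at $v$, the block of $U$ containing $v$ is a complete bipartite graph.
   Context: Graphs are finite, undirected, no multiple edges; bipartite graphs have no loops. $\Gamma(v)$ is the neighbourhood of $v$, and $B_2(v)$ is the subgraph of $H$ induced by $\Gamma(v)\cup\Gamma(\Gamma(v))$. For a graph $B$ and $v\in V(B)$, the components of the split of $B$ at $v$ are the induced subgraphs $B[V(C)\cup\{v\}]$ where $C$ ranges over the connected components of $B-v$. A block of a graph is a maximal biconnected subgraph (a single edge or isolated vertex counts as biconnected). $K_{3,3}\setminus\{e\}$ is $K_{3,3}$ minus one edge; the domino is the $2\times3$ grid graph. -}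

module Defs where

open import Data.Nat using (ℕ; _≤_; _≡ᵇ_; _<ᵇ_)
open import Data.Bool using (Bool; true; false; _∧_; _∨_; _xor_; not)
open import Data.Fin using (Fin; toℕ)
open import Data.Fin.Subset using (Subset; _∈_; _⊆_; _∪_; _-_; ⁅_⁆; ∣_∣)
open import Data.List using (List; []; _∷_; allFin)
open import Data.Bool.ListAction using (any)
open import Data.Vec using (tabulate)
open import Data.Product using (Σ; ∃; _×_; _,_)
open import Data.Sum using (_⊎_)
open import Relation.Binary.PropositionalEquality using (_≡_; _≢_)
open import Function.Definitions using (Injective)
open import Function.Bundles using (_⇔_)

record Graph (n : ℕ) : Set where
  field
    adj    : Fin n → Fin n → Bool
    sym    : ∀ u v → adj u v ≡ adj v u
    irrefl : ∀ v → adj v v ≡ false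
open Graph public

module _ {n : ℕ} (H : Graph n) where

  Adj : Fin n → Fin n → Set
  Adj u v = adj H u v ≡ true

  Bipartite : Set
  Bipartite = Σ (Fin n → Bool) λ c → ∀ u v → Adj u v → c u ≢ c v

  HasInduced : {k : ℕ} → (Fin k → Fin k → Bool) → Set
  HasInduced {k} F = Σ (Fin k → Fin n) λ f →
    Injective _≡_ _≡_ f × (∀ i j → adj H (f i) (f j) ≡ F i j)

  Ball2 : Fin n → Subset n
  Ball2 v = tabulate λ u → adj H v u ∨ any (λ w → adj H v w ∧ adj H w u) (allFin n)

  data Reach (S : Subset n) : Fin n → Fin n → Set where
    here : ∀ {v} → v ∈ S → Reach S v v
    step : ∀ {u w v} → u ∈ S → Adj u w → Reach S w v → Reach S u v

  Connected : Subset n → Set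
  Connected S = (∃ λ v → v ∈ S) × (∀ u v → u ∈ S → v ∈ S → Reach S u v)

  IsComponent : Subset n → Subset n → Set
  IsComponent S C = C ⊆ S × Connected C ×
    (∀ C' → C ⊆ C' → C' ⊆ S → Connected C' → C' ⊆ C)

  IsSplitComponent : Subset n → Fin n → Subset n → Set
  IsSplitComponent S v U = v ∈ S × Σ (Subset n) λ C → IsComponent (S - v) C × U ≡ C ∪ ⁅ v ⁆

  -- H[T] is biconnected: connected, and if it has ≥ 3 vertices it has no cut vertex
  -- (so a single vertex or a single edge counts as biconnected)
  Biconnected : Subset n → Set
  Biconnected T = Connected T × (3 ≤ ∣ T ∣ → ∀ x → x ∈ T → Connected (T - x))

  -- T is (the vertex set of) a block of H[U] containing v.
  -- Blocks are induced subgraphs, so they are determined by their vertex sets.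
  IsBlockAt : Subset n → Fin n → Subset n → Set
  IsBlockAt U v T = T ⊆ U × v ∈ T × Biconnected T ×
    (∀ T' → T ⊆ T' → T' ⊆ U → Biconnected T' → T' ⊆ T)

  CompleteBipartite : Subset n → Set
  CompleteBipartite T = Σ (Fin n → Bool) λ c →
    ∀ u w → u ∈ T → w ∈ T → (Adj u w ⇔ (c u ≢ c w))

K33-e : Fin 6 → Fin 6 → Bool
K33-e i j = ((a <ᵇ 3) xor (b <ᵇ 3)) ∧ not (((a ≡ᵇ 0) ∧ (b ≡ᵇ 3)) ∨ ((a ≡ᵇ 3) ∧ (b ≡ᵇ 0)))
  where
  a = toℕ i
  b = toℕ j

-- the domino (2×3 grid), vertex (r , c) ↦ 3r + c
dominoEdges : List (ℕ × ℕ)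
dominoEdges = (0 , 1) ∷ (1 , 2) ∷ (3 , 4) ∷ (4 , 5) ∷ (0 , 3) ∷ (1 , 4) ∷ (2 , 5) ∷ []

Domino : Fin 6 → Fin 6 → Bool
Domino i j = any edge dominoEdges
  where
  edge : ℕ × ℕ → Bool
  edge (a , b) = ((a ≡ᵇ toℕ i) ∧ (b ≡ᵇ toℕ j)) ∨ ((a ≡ᵇ toℕ j) ∧ (b ≡ᵇ toℕ i))

-- Fix a proper 2-colouring; a vertex of B₂(v) coloured unlike v is a neighbour of v.
-- Forward: let T ∋ v be biconnected inside B₂(v).  A vertex a of T coloured like v is adjacent
-- to every x of T coloured unlike v, by induction along a walk a → w → y → … → x in T − v:
-- y ~ x by induction, and if a ≁ x then a, v, y against x, w and a second neighbour of a in T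
-- (biconnectivity) induce K₃,₃∖{e} or the domino.  Conversely, each forbidden graph contains a
-- hexagon with a non-adjacent pair of opposite corners, all of whose corners lie in B₂ of one
-- corner.  The corners form a biconnected set, so they lie in one block of a split component
-- of that B₂; but in a complete bipartite graph the ends of a path of length 3 are adjacent.
module Submission where

open import Defs renaming (sym to adj-sym)
open import Data.Nat using (ℕ; suc; _+_; _∸_; _≤_; _<_; _<?_; s≤s; z≤n)
open import Data.Nat.Properties using (≤-trans; ∸-monoʳ-<)
open import Data.Nat.DivMod using (_%_; m%n<n)
open import Data.Nat.Induction using (<-wellFounded)
open import Data.Bool using (Bool; true; false; T)
open import Data.Bool.Properties using (T-≡; T-∨; T-∧; ¬-not) renaming (_≟_ to _≟ᵇ_)
open import Data.Bool.ListAction using (any)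
open import Data.Fin using (Fin; zero; suc; toℕ; fromℕ<; splitAt)
open import Data.Fin.Patterns using (0F; 1F; 2F; 3F; 4F; 5F)
open import Data.Fin.Properties using (_≟_; all?; any?; splitAt⁻¹-↑ˡ; splitAt⁻¹-↑ʳ)
open import Data.Fin.Subset using (Subset; _∈_; _∉_; _⊆_; _∪_; _-_; ⁅_⁆; ∣_∣)
open import Data.Fin.Subset.Properties
  using (_∈?_; ⊆-refl; ⊆-trans; p─q⊆p; x∈p∧x≢y⇒x∈p-y; x∈p⇒∣p-x∣<∣p∣; p⊂q⇒∣p∣<∣q∣; ∣p∣≤n;
         x∈⁅x⁆; x∈⁅y⁆⇒x≡y; x∈p∪q⁻; x∈p∪q⁺)
open import Data.List using (allFin)
open import Data.List.Relation.Unary.Any.Properties using (any⁺; any⁻; tabulate⁺; tabulate⁻)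
open import Data.Vec as Vec using (tabulate; there)
open import Data.Vec.Properties using (lookup∘tabulate; []=⇒lookup; lookup⇒[]=)
open import Data.Vec.Functional using (_∷_; [])
open import Data.Product using (∃; _×_; _,_; proj₂)
open import Data.Sum using (_⊎_; inj₁; inj₂; [_,_]′)
open import Data.Empty using (⊥-elim)
open import Data.Unit using (⊤; tt)
open import Function using (_∘_; _on_; id)
open import Function.Bundles using (Equivalence; mk⇔; _⇔_)
open import Function.Definitions using (Injective)
open import Induction.WellFounded using (Acc; acc)
import Relation.Binary.Construct.On as On
open import Relation.Nullary using (¬_; yes; no; ¬?)
open import Relation.Nullary.Decidable using (Dec; isYes; toWitness; fromWitness; _→-dec_; _×-dec_; _⊎-dec_)
open import Relation.Binary.PropositionalEquality using (_≡_; _≢_; refl; sym; trans; cong; subst; ≢-sym)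

x≢y∧y≢z⇒x≡z : ∀ {x y z : Bool} → x ≢ y → y ≢ z → x ≡ z
x≢y∧y≢z⇒x≡z x≢y y≢z = trans (¬-not x≢y) (sym (¬-not (≢-sym y≢z)))

splitAt-injective : ∀ p {q} {i j : Fin (p + q)} → splitAt p i ≡ splitAt p j → i ≡ j
splitAt-injective p {i = i} e with splitAt p i in eq
... | inj₁ _ = trans (sym (splitAt⁻¹-↑ˡ eq)) (splitAt⁻¹-↑ˡ (sym e))
... | inj₂ _ = trans (sym (splitAt⁻¹-↑ʳ eq)) (splitAt⁻¹-↑ʳ (sym e))

triple-injective : ∀ {A : Set} {x y z : A} → x ≢ y → x ≢ z → y ≢ z → Injective _≡_ _≡_ (x ∷ y ∷ z ∷ [])
triple-injective x≢y x≢z y≢z {0F} {0F} _ = refl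
triple-injective x≢y x≢z y≢z {0F} {1F} e = ⊥-elim (x≢y e)
triple-injective x≢y x≢z y≢z {0F} {2F} e = ⊥-elim (x≢z e)
triple-injective x≢y x≢z y≢z {1F} {0F} e = ⊥-elim (x≢y (sym e))
triple-injective x≢y x≢z y≢z {1F} {1F} _ = refl
triple-injective x≢y x≢z y≢z {1F} {2F} e = ⊥-elim (y≢z e)
triple-injective x≢y x≢z y≢z {2F} {0F} e = ⊥-elim (x≢z (sym e))
triple-injective x≢y x≢z y≢z {2F} {1F} e = ⊥-elim (y≢z (sym e))
triple-injective x≢y x≢z y≢z {2F} {2F} _ = refl

x∉p-x : ∀ {n} (p : Subset n) x → x ∉ p - x
x∉p-x (_ Vec.∷ p) zero ()
x∉p-x (_ Vec.∷ p) (suc x) (there x∈) = x∉p-x p x x∈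

module _ {n : ℕ} where

  x∈p-y⇒x≢y : ∀ {p : Subset n} {x y} → x ∈ p - y → x ≢ y
  x∈p-y⇒x≢y {p} {x} x∈ refl = x∉p-x p x x∈

  x∈p-y⇒x∈p : ∀ {p : Subset n} {x y} → x ∈ p - y → x ∈ p
  x∈p-y⇒x∈p {p} {y = y} = p─q⊆p p ⁅ y ⁆

  3≤∣p∣ : ∀ {p : Subset n} {x y z} → x ∈ p → y ∈ p → z ∈ p → x ≢ y → x ≢ z → y ≢ z → 3 ≤ ∣ p ∣
  3≤∣p∣ x∈p y∈p z∈p x≢y x≢z y≢z =
    ≤-trans (s≤s (≤-trans (s≤s (≤-trans (s≤s z≤n) (x∈p⇒∣p-x∣<∣p∣ z∈p-x-y)))
                          (x∈p⇒∣p-x∣<∣p∣ y∈p-x)))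
            (x∈p⇒∣p-x∣<∣p∣ x∈p)
    where
    y∈p-x = x∈p∧x≢y⇒x∈p-y y∈p (≢-sym x≢y)
    z∈p-x-y = x∈p∧x≢y⇒x∈p-y (x∈p∧x≢y⇒x∈p-y z∈p (≢-sym x≢z)) (≢-sym y≢z)

  ∈-tabulate⁺ : ∀ {f : Fin n → Bool} {x} → T (f x) → x ∈ tabulate f
  ∈-tabulate⁺ {f} {x} t = lookup⇒[]= x _ (trans (lookup∘tabulate f x) (Equivalence.to T-≡ t))

  ∈-tabulate⁻ : ∀ {f : Fin n → Bool} {x} → x ∈ tabulate f → T (f x)
  ∈-tabulate⁻ {f} {x} x∈ = Equivalence.from T-≡ (trans (sym (lookup∘tabulate f x)) ([]=⇒lookup x∈))

  T-any-allFin⁺ : ∀ {p : Fin n → Bool} i → T (p i) → T (any p (allFin n))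
  T-any-allFin⁺ {p} i t = any⁺ p (tabulate⁺ i t)

  T-any-allFin⁻ : ∀ {p : Fin n → Bool} → T (any p (allFin n)) → ∃ λ i → T (p i)
  T-any-allFin⁻ {p} t = tabulate⁻ (any⁻ p (allFin n) t)

  Maximal : (Subset n → Set) → Subset n → Set
  Maximal P X = P X × (∀ Y → X ⊆ Y → P Y → Y ⊆ X)

  -- Constructively only up to ¬¬; enough, since maximal sets are only used to reach a contradiction.
  ¬¬-maximal : ∀ (P : Subset n → Set) {X} → P X → ¬ ¬ (∃ λ Y → X ⊆ Y × Maximal P Y)
  ¬¬-maximal P {X} pX = go X (On.wellFounded missing <-wellFounded X) pX
    where
    missing : Subset n → ℕ
    missing Y = n ∸ ∣ Y ∣

    go : ∀ X → Acc (_<_ on missing) X → P X → ¬ ¬ (∃ λ Y → X ⊆ Y × Maximal P Y)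
    go X (acc rec) pX no-maximal = no-maximal (X , ⊆-refl , pX , maximal)
      where
      maximal : ∀ Y → X ⊆ Y → P Y → Y ⊆ X
      maximal Y X⊆Y pY {x} x∈Y with x ∈? X
      ... | yes x∈X = x∈X
      ... | no x∉X = ⊥-elim (go Y (rec fewer) pY λ (Z , Y⊆Z , Z-max) →
                                 no-maximal (Z , ⊆-trans X⊆Y Y⊆Z , Z-max))
        where
        fewer : missing Y < missing X
        fewer = ∸-monoʳ-< (p⊂q⇒∣p∣<∣q∣ (X⊆Y , x , x∈Y , x∉X)) (∣p∣≤n Y)

image : ∀ {m n} → (Fin m → Fin n) → Subset n
image {m} g = tabulate λ u → any (λ i → isYes (g i ≟ u)) (allFin m)

module _ {m n : ℕ} (g : Fin m → Fin n) where

  ∈-image : ∀ i → g i ∈ image g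
  ∈-image i = ∈-tabulate⁺ (T-any-allFin⁺ i (fromWitness refl))

  image⁻ : ∀ {u} → u ∈ image g → ∃ λ i → g i ≡ u
  image⁻ u∈ with T-any-allFin⁻ (∈-tabulate⁻ u∈)
  ... | i , t = i , toWitness t

module _ {n : ℕ} (H : Graph n) where

  Adj-sym : ∀ {u w} → Adj H u w → Adj H w u
  Adj-sym {u} {w} e = trans (adj-sym H w u) e

  Adj⇒≢ : ∀ {u w} → Adj H u w → u ≢ w
  Adj⇒≢ {u} e refl with trans (sym e) (irrefl H u)
  ... | ()

  non-adj⇒¬Adj : ∀ {u w} → adj H u w ≡ false → ¬ Adj H u w
  non-adj⇒¬Adj f e with trans (sym e) f
  ... | ()

  Adj∧non-adj⇒≢ : ∀ {u u' w} → Adj H u w → adj H u' w ≡ false → u ≢ u'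
  Adj∧non-adj⇒≢ e f refl = non-adj⇒¬Adj f e

  Reach-source : ∀ {S a b} → Reach H S a b → a ∈ S
  Reach-source (here a∈) = a∈
  Reach-source (step a∈ _ _) = a∈

  Reach-trans : ∀ {S a b d} → Reach H S a b → Reach H S b d → Reach H S a d
  Reach-trans (here _) r = r
  Reach-trans (step a∈ e r) r' = step a∈ e (Reach-trans r r')

  Reach-sym : ∀ {S a b} → Reach H S a b → Reach H S b a
  Reach-sym (here a∈) = here a∈
  Reach-sym (step a∈ e r) = Reach-trans (Reach-sym r) (step (Reach-source r) (Adj-sym e) (here a∈))

  Reach-first-step : ∀ {S a b} → Reach H S a b → a ≢ b → ∃ λ x → x ∈ S × Adj H a x
  Reach-first-step (here _) a≢b = ⊥-elim (a≢b refl)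
  Reach-first-step (step _ e r) _ = _ , Reach-source r , e

  hub⇒Connected : ∀ {X r} → r ∈ X → (∀ {u} → u ∈ X → Reach H X u r) → Connected H X
  hub⇒Connected r∈X reach = (_ , r∈X) , λ u w u∈ w∈ → Reach-trans (reach u∈) (Reach-sym (reach w∈))

  reach-root : ∀ {m X} (g : Fin m → Fin n) {J : Fin m → Set} (root : Fin m) (parent : Fin m → Fin m)
    (depth : Fin m → ℕ) → (∀ {i} → J i → g i ∈ X) →
    (∀ {i} → J i → i ≢ root → J (parent i) × Adj H (g i) (g (parent i)) × depth (parent i) < depth i) →
    ∀ {i} → J i → Reach H X (g i) (g root)
  reach-root {X = X} g {J} root parent depth ∈X descend {i} = go i (<-wellFounded (depth i))
    where
    go : ∀ i → Acc _<_ (depth i) → J i → Reach H X (g i) (g root)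
    go i (acc rec) Ji with i ≟ root | descend Ji
    ... | yes refl | _ = here (∈X Ji)
    ... | no i≢root | d with d i≢root
    ... | Jp , edge , shallower = step (∈X Ji) edge (go (parent i) (rec shallower) Jp)

  second-neighbour : ∀ {T a w z} → Biconnected H T → a ∈ T → w ∈ T → z ∈ T → a ≢ z → w ≢ z →
    Adj H a w → ∃ λ x → x ∈ T × x ≢ w × Adj H a x
  second-neighbour (_ , cut-free) a∈ w∈ z∈ a≢z w≢z aw
    with Reach-first-step (proj₂ (cut-free (3≤∣p∣ a∈ w∈ z∈ (Adj⇒≢ aw) a≢z w≢z) _ w∈) _ _
           (x∈p∧x≢y⇒x∈p-y a∈ (Adj⇒≢ aw)) (x∈p∧x≢y⇒x∈p-y z∈ (≢-sym w≢z))) a≢z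
  ... | x , x∈ , ax = x , x∈p-y⇒x∈p x∈ , x∈p-y⇒x≢y x∈ , ax

  Adj⇒∈Ball2 : ∀ {v u} → Adj H v u → u ∈ Ball2 H v
  Adj⇒∈Ball2 e = ∈-tabulate⁺ (Equivalence.from T-∨ (inj₁ (Equivalence.from T-≡ e)))

  Adj²⇒∈Ball2 : ∀ {v w u} → Adj H v w → Adj H w u → u ∈ Ball2 H v
  Adj²⇒∈Ball2 {w = w} e₁ e₂ = ∈-tabulate⁺ (Equivalence.from T-∨ (inj₂ (T-any-allFin⁺ w
    (Equivalence.from T-∧ (Equivalence.from T-≡ e₁ , Equivalence.from T-≡ e₂)))))

  ∈Ball2⁻ : ∀ {v u} → u ∈ Ball2 H v → Adj H v u ⊎ ∃ λ w → Adj H v w × Adj H w u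
  ∈Ball2⁻ u∈ with Equivalence.to T-∨ (∈-tabulate⁻ u∈)
  ... | inj₁ t = inj₁ (Equivalence.to T-≡ t)
  ... | inj₂ t with T-any-allFin⁻ t
  ... | w , t' with Equivalence.to T-∧ t'
  ... | t₁ , t₂ = inj₂ (w , Equivalence.to T-≡ t₁ , Equivalence.to T-≡ t₂)

  split-component⊆ : ∀ {S v U} → IsSplitComponent H S v U → U ⊆ S
  split-component⊆ {S} {v} (v∈S , C , (C⊆S-v , _) , refl) u∈ with x∈p∪q⁻ C ⁅ v ⁆ u∈
  ... | inj₁ u∈C = x∈p-y⇒x∈p (C⊆S-v u∈C)
  ... | inj₂ u∈v = subst (_∈ S) (sym (x∈⁅y⁆⇒x≡y v u∈v)) v∈S

  CompleteBipartite-P₄ : ∀ {T p a b q} → CompleteBipartite H T → p ∈ T → a ∈ T → b ∈ T → q ∈ T →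
    Adj H p a → Adj H a b → Adj H b q → Adj H p q
  CompleteBipartite-P₄ (col , iff) p∈ a∈ b∈ q∈ pa ab bq =
    Equivalence.from (iff _ _ p∈ q∈) λ same → separates b∈ q∈ bq (trans (sym p≡b) same)
    where
    separates : ∀ {x y} → x ∈ _ → y ∈ _ → Adj H x y → col x ≢ col y
    separates x∈ y∈ = Equivalence.to (iff _ _ x∈ y∈)
    p≡b = x≢y∧y≢z⇒x≡z (separates p∈ a∈ pa) (separates a∈ b∈ ab)

  HasInduced-relabel : ∀ {k m} {F : Fin m → Fin m → Bool} {G : Fin k → Fin k → Bool}
    (π : Fin k → Fin m) →
    (∀ i j → π i ≡ π j → i ≡ j) → (∀ i j → G i j ≡ F (π i) (π j)) → HasInduced H F → HasInduced H G
  HasInduced-relabel π π-inj G≗F (f , f-inj , f-adj) =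
    f ∘ π , (λ e → π-inj _ _ (f-inj e)) , λ i j → trans (f-adj (π i) (π j)) (sym (G≗F i j))

biadjacent : ∀ {p q} → (Fin p → Fin q → Bool) → Fin p ⊎ Fin q → Fin p ⊎ Fin q → Bool
biadjacent B (inj₁ a) (inj₂ b) = B a b
biadjacent B (inj₂ b) (inj₁ a) = B a b
biadjacent B _        _        = false

fromBiadjacency : ∀ {p q} → (Fin p → Fin q → Bool) → Fin (p + q) → Fin (p + q) → Bool
fromBiadjacency {p} B i j = biadjacent B (splitAt p i) (splitAt p j)

-- K₃,₃ minus the edge 0–0, and also minus 2–2 unless b: K₃,₃∖{e} for b = true, the domino for b = false.
K33-minus : Bool → Fin 3 → Fin 3 → Bool
K33-minus b 0F 0F = false
K33-minus b 2F 2F = b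
K33-minus b _  _  = true

injective? : ∀ {k m} (π : Fin k → Fin m) → Dec (∀ i j → π i ≡ π j → i ≡ j)
injective? π = all? λ i → all? λ j → π i ≟ π j →-dec i ≟ j

K33-e-biadjacency : ∀ i j → K33-e i j ≡ fromBiadjacency (K33-minus true) i j
K33-e-biadjacency = toWitness {a? = all? λ i → all? λ j → K33-e i j ≟ᵇ fromBiadjacency (K33-minus true) i j} _

Domino-relabelling : Fin 6 → Fin 6
Domino-relabelling = 3F ∷ 1F ∷ 5F ∷ 2F ∷ 4F ∷ 0F ∷ []

Domino-relabelling-injective : ∀ i j → Domino-relabelling i ≡ Domino-relabelling j → i ≡ j
Domino-relabelling-injective = toWitness {a? = injective? Domino-relabelling} _

Domino-biadjacency : ∀ i j → Domino i j ≡ (fromBiadjacency (K33-minus false) on Domino-relabelling) i j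
Domino-biadjacency = toWitness {a? = all? λ i → all? λ j →
  Domino i j ≟ᵇ (fromBiadjacency (K33-minus false) on Domino-relabelling) i j} _

K33-minus-induced : ∀ {n} (H : Graph n) b → HasInduced H (fromBiadjacency (K33-minus b)) →
  HasInduced H K33-e ⊎ HasInduced H Domino
K33-minus-induced H true  = inj₁ ∘ HasInduced-relabel H id (λ _ _ → id) K33-e-biadjacency
K33-minus-induced H false =
  inj₂ ∘ HasInduced-relabel H Domino-relabelling Domino-relabelling-injective Domino-biadjacency

module ProperColouring {n : ℕ} (H : Graph n) (c : Fin n → Bool) (proper : ∀ u w → Adj H u w → c u ≢ c w)
  where

  same-colour⇒non-adj : ∀ {u w} → c u ≡ c w → adj H u w ≡ false
  same-colour⇒non-adj {u} {w} same with adj H u w in e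
  ... | true = ⊥-elim (proper u w e same)
  ... | false = refl

  Adj²⇒same-colour : ∀ {u w z} → Adj H u w → Adj H w z → c u ≡ c z
  Adj²⇒same-colour {u} {w} {z} uw wz = x≢y∧y≢z⇒x≡z (proper u w uw) (proper w z wz)

  biadjacency-induced : ∀ {p q} (B : Fin p → Fin q → Bool) (l : Fin p → Fin n) (r : Fin q → Fin n) s →
    Injective _≡_ _≡_ l → Injective _≡_ _≡_ r → (∀ i → c (l i) ≡ s) → (∀ j → c (r j) ≢ s) →
    (∀ i j → adj H (l i) (r j) ≡ B i j) → HasInduced H (fromBiadjacency B)
  biadjacency-induced {p} B l r s l-inj r-inj l-col r-col lr =
    [ l , r ]′ ∘ splitAt p ,
    (λ e → splitAt-injective p (sides-injective _ _ e)) ,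
    λ i j → sides-adj (splitAt p i) (splitAt p j)
    where
    sides-adj : ∀ x y → adj H ([ l , r ]′ x) ([ l , r ]′ y) ≡ biadjacent B x y
    sides-adj (inj₁ a) (inj₁ a') = same-colour⇒non-adj (trans (l-col a) (sym (l-col a')))
    sides-adj (inj₁ a) (inj₂ b)  = lr a b
    sides-adj (inj₂ b) (inj₁ a)  = trans (adj-sym H (r b) (l a)) (lr a b)
    sides-adj (inj₂ b) (inj₂ b') = same-colour⇒non-adj (x≢y∧y≢z⇒x≡z (r-col b) (≢-sym (r-col b')))

    sides-injective : ∀ x y → [ l , r ]′ x ≡ [ l , r ]′ y → x ≡ y
    sides-injective (inj₁ a) (inj₁ a') e = cong inj₁ (l-inj e)
    sides-injective (inj₁ a) (inj₂ b)  e = ⊥-elim (r-col b (trans (cong c (sym e)) (l-col a)))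
    sides-injective (inj₂ b) (inj₁ a)  e = ⊥-elim (r-col b (trans (cong c e) (l-col a)))
    sides-injective (inj₂ b) (inj₂ b') e = cong inj₂ (r-inj e)

  K33-e-or-domino : ∀ {a v y x₀ x₁ x₂} →
    Adj H v x₀ → Adj H v x₁ → Adj H v x₂ → Adj H y x₀ → Adj H y x₁ → Adj H a x₁ → Adj H a x₂ →
    adj H a x₀ ≡ false → v ≢ y → x₁ ≢ x₂ → HasInduced H K33-e ⊎ HasInduced H Domino
  K33-e-or-domino {a} {v} {y} {x₀} {x₁} {x₂} vx₀ vx₁ vx₂ yx₀ yx₁ ax₁ ax₂ ax₀ v≢y x₁≢x₂ =
    K33-minus-induced H (adj H y x₂)
      (biadjacency-induced (K33-minus (adj H y x₂)) left right (c v)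
        (triple-injective (≢-sym (Adj∧non-adj⇒≢ H vx₀ ax₀)) (≢-sym (Adj∧non-adj⇒≢ H yx₀ ax₀)) v≢y)
        (triple-injective (≢-sym (a-neighbour≢x₀ ax₁)) (≢-sym (a-neighbour≢x₀ ax₂)) x₁≢x₂)
        left-colour right-colour table)
    where
    left right : Fin 3 → Fin n
    left  = a ∷ v ∷ y ∷ []
    right = x₀ ∷ x₁ ∷ x₂ ∷ []

    a-neighbour≢x₀ : ∀ {x} → Adj H a x → x ≢ x₀
    a-neighbour≢x₀ ax = Adj∧non-adj⇒≢ H (Adj-sym H ax) (trans (adj-sym H x₀ a) ax₀)

    left-colour : ∀ i → c (left i) ≡ c v
    left-colour 0F = Adj²⇒same-colour ax₁ (Adj-sym H vx₁)
    left-colour 1F = refl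
    left-colour 2F = Adj²⇒same-colour yx₀ (Adj-sym H vx₀)

    right-colour : ∀ j → c (right j) ≢ c v
    right-colour 0F = ≢-sym (proper _ _ vx₀)
    right-colour 1F = ≢-sym (proper _ _ vx₁)
    right-colour 2F = ≢-sym (proper _ _ vx₂)

    table : ∀ i j → adj H (left i) (right j) ≡ K33-minus (adj H y x₂) i j
    table 0F 0F = ax₀
    table 0F 1F = ax₁
    table 0F 2F = ax₂
    table 1F 0F = vx₀
    table 1F 1F = vx₁
    table 1F 2F = vx₂
    table 2F 0F = yx₀
    table 2F 1F = yx₁
    table 2F 2F = refl

module BiconnectedBall {n : ℕ} {H : Graph n} {c : Fin n → Bool} (proper : ∀ u w → Adj H u w → c u ≢ c w)
  (K33-e-free : ¬ HasInduced H K33-e) (domino-free : ¬ HasInduced H Domino)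
  {v : Fin n} {T : Subset n} (T-biconnected : Biconnected H T) (T⊆B₂ : T ⊆ Ball2 H v) (v∈T : v ∈ T) where

  open ProperColouring H c proper

  far⇒neighbour : ∀ {x} → x ∈ T → c x ≢ c v → Adj H v x
  far⇒neighbour x∈ cx with ∈Ball2⁻ H (T⊆B₂ x∈)
  ... | inj₁ vx = vx
  ... | inj₂ (_ , vw , wx) = ⊥-elim (cx (sym (Adj²⇒same-colour vw wx)))

  P₄⇒adjacent : ∀ {a w y x} → a ∈ T - v → w ∈ T - v → y ≢ v → x ∈ T → c x ≢ c v → c a ≡ c v →
    Adj H a w → Adj H y w → Adj H y x → Adj H a x
  P₄⇒adjacent {a} {w} {y} {x} a∈ w∈ y≢v x∈ cx ca aw yw yx with adj H a x in ax
  ... | true = refl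
  ... | false with second-neighbour H T-biconnected (x∈p-y⇒x∈p a∈) (x∈p-y⇒x∈p w∈) v∈T
                     (x∈p-y⇒x≢y a∈) (x∈p-y⇒x≢y w∈) aw
  ... | x₂ , x₂∈ , x₂≢w , ax₂ = ⊥-elim ([ K33-e-free , domino-free ]′
          (K33-e-or-domino (far⇒neighbour x∈ cx) (far⇒neighbour (x∈p-y⇒x∈p w∈) (far aw))
             (far⇒neighbour x₂∈ (far ax₂)) yx yw aw ax₂ ax (≢-sym y≢v) (≢-sym x₂≢w)))
    where
    far : ∀ {z} → Adj H a z → c z ≢ c v
    far az cz = proper _ _ az (trans ca (sym cz))

  near⇒adjacent : ∀ {a x} → x ∈ T → c x ≢ c v → Reach H (T - v) a x → c a ≡ c v → Adj H a x
  near⇒adjacent x∈ cx (here _) ca = ⊥-elim (cx ca)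
  near⇒adjacent x∈ cx (step _ aw (here _)) _ = aw
  near⇒adjacent x∈ cx (step a∈ aw (step w∈ ww' r)) ca =
    P₄⇒adjacent a∈ w∈ (x∈p-y⇒x≢y (Reach-source H r)) x∈ cx ca aw (Adj-sym H ww')
      (near⇒adjacent x∈ cx r (trans (Adj²⇒same-colour (Adj-sym H ww') (Adj-sym H aw)) ca))

  near-far⇒adjacent : ∀ {y x} → y ∈ T → x ∈ T → c y ≡ c v → c x ≢ c v → Adj H y x
  near-far⇒adjacent {y} {x} y∈ x∈ cy cx with y ≟ v
  ... | yes refl = far⇒neighbour x∈ cx
  ... | no y≢v = near⇒adjacent x∈ cx
          (proj₂ (proj₂ T-biconnected size v v∈T) y x (x∈p∧x≢y⇒x∈p-y y∈ y≢v) (x∈p∧x≢y⇒x∈p-y x∈ x≢v)) cy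
    where
    x≢v : x ≢ v
    x≢v = cx ∘ cong c
    size : 3 ≤ ∣ T ∣
    size = 3≤∣p∣ v∈T y∈ x∈ (≢-sym y≢v) (≢-sym x≢v) (λ e → cx (trans (cong c (sym e)) cy))

  complete-bipartite : CompleteBipartite H T
  complete-bipartite = c , λ u w u∈ w∈ → mk⇔ (proper u w) (adjacent u∈ w∈)
    where
    adjacent : ∀ {u w} → u ∈ T → w ∈ T → c u ≢ c w → Adj H u w
    adjacent {u} {w} u∈ w∈ cu≢cw with c u ≟ᵇ c v
    ... | yes cu = near-far⇒adjacent u∈ w∈ cu (λ cw → cu≢cw (trans cu (sym cw)))
    ... | no cu≢cv = Adj-sym H (near-far⇒adjacent w∈ u∈ (x≢y∧y≢z⇒x≡z (≢-sym cu≢cw) cu≢cv) cu≢cv)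

LocalBlocksComplete : ∀ {n} → Graph n → Set
LocalBlocksComplete {n} H = ∀ (v : Fin n) (U T : Subset n) →
  IsSplitComponent H (Ball2 H v) v U → IsBlockAt H U v T → CompleteBipartite H T

K33-e-domino-free⇒blocks-complete : ∀ {n} {H : Graph n} {c : Fin n → Bool} →
  (∀ u w → Adj H u w → c u ≢ c w) → ¬ HasInduced H K33-e → ¬ HasInduced H Domino → LocalBlocksComplete H
K33-e-domino-free⇒blocks-complete {H = H} proper K33-e-free domino-free v U T split
  (T⊆U , v∈T , T-biconnected , _) =
  BiconnectedBall.complete-bipartite proper K33-e-free domino-free T-biconnected
    (split-component⊆ H split ∘ T⊆U) v∈T

module _ {n : ℕ} {H : Graph n} (blocks-complete : LocalBlocksComplete H) where

  biconnected-in-ball⇒complete : ∀ {v X} → X ⊆ Ball2 H v → v ∈ X → Biconnected H X → 3 ≤ ∣ X ∣ →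
    ¬ ¬ (∃ λ T → X ⊆ T × CompleteBipartite H T)
  biconnected-in-ball⇒complete {v} {X} X⊆B₂ v∈X X-biconnected 3≤∣X∣ no-T =
    ¬¬-maximal (λ C → C ⊆ Ball2 H v - v × Connected H C) (X-v⊆B₂-v , proj₂ X-biconnected 3≤∣X∣ v v∈X)
      λ (C , X-v⊆C , (C⊆B₂-v , C-connected) , C-maximal) →
        ¬¬-maximal (λ T → T ⊆ C ∪ ⁅ v ⁆ × Biconnected H T) (X⊆C+v X-v⊆C , X-biconnected)
          λ (T , X⊆T , (T⊆U , T-biconnected) , T-maximal) →
            no-T (T , X⊆T , blocks-complete v (C ∪ ⁅ v ⁆) T
              (X⊆B₂ v∈X , C , (C⊆B₂-v , C-connected , λ C' C⊆C' C'⊆ C'-connected →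
                 C-maximal C' C⊆C' (C'⊆ , C'-connected)) , refl)
              (T⊆U , X⊆T v∈X , T-biconnected , λ T' T⊆T' T'⊆U T'-biconnected →
                 T-maximal T' T⊆T' (T'⊆U , T'-biconnected)))
    where
    X-v⊆B₂-v : X - v ⊆ Ball2 H v - v
    X-v⊆B₂-v x∈ = x∈p∧x≢y⇒x∈p-y (X⊆B₂ (x∈p-y⇒x∈p x∈)) (x∈p-y⇒x≢y x∈)

    X⊆C+v : ∀ {C} → X - v ⊆ C → X ⊆ C ∪ ⁅ v ⁆
    X⊆C+v X-v⊆C {x} x∈ with x ≟ v
    ... | yes refl = x∈p∪q⁺ (inj₂ (x∈⁅x⁆ x))
    ... | no x≢v = x∈p∪q⁺ (inj₁ (X-v⊆C (x∈p∧x≢y⇒x∈p-y x∈ x≢v)))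

next : ∀ {m} → Fin (suc m) → Fin (suc m)
next {m} i = fromℕ< (m%n<n (suc (toℕ i)) (suc m))

prev : ∀ {m} → Fin (suc m) → Fin (suc m)
prev {m} i = fromℕ< (m%n<n (m + toℕ i) (suc m))

distance : ∀ {m} → Fin (suc m) → Fin (suc m) → ℕ
distance {m} i k = (suc m + toℕ k ∸ toℕ i) % suc m

distance-next : ∀ k i → i ≢ k → distance {5} (next i) k < distance i k
distance-next =
  toWitness {a? = all? λ k → all? λ i → ¬? (i ≟ k) →-dec distance (next i) k <? distance i k} _

prev-next : ∀ i → prev {5} (next i) ≡ i
prev-next = toWitness {a? = all? λ i → prev (next i) ≟ i} _

prev-≢ : ∀ i → prev {5} i ≢ i
prev-≢ = toWitness {a? = all? λ i → ¬? (prev i ≟ i)} _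

record CentredHexagon {n : ℕ} (H : Graph n) : Set where
  field
    corner : Fin 6 → Fin n
    corner-injective : Injective _≡_ _≡_ corner
    rim : ∀ i → Adj H (corner i) (corner (next i))
    hub : Fin 6
    near-hub : ∀ i → corner i ∈ Ball2 H (corner hub)
    long-diagonal : adj H (corner 0F) (corner 3F) ≡ false

module _ {n : ℕ} {H : Graph n} (hexagon : CentredHexagon H) where
  open CentredHexagon hexagon

  corners : Subset n
  corners = image corner

  corners-connected : Connected H corners
  corners-connected = hub⇒Connected H (∈-image corner 0F) reach
    where
    reach : ∀ {u} → u ∈ corners → Reach H corners u (corner 0F)
    reach u∈ with image⁻ corner u∈
    ... | i , refl = reach-root H corner {J = λ _ → ⊤} 0F next (λ i → distance i 0F)
                       (λ _ → ∈-image corner _)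
                       (λ _ i≢0 → tt , rim _ , distance-next 0F _ i≢0) tt

  -- Walking forward from any corner other than j reaches the corner before j without meeting j.
  corners-minus-connected : ∀ j → Connected H (corners - corner j)
  corners-minus-connected j = hub⇒Connected H (member (prev-≢ j)) reach
    where
    member : ∀ {i} → i ≢ j → corner i ∈ corners - corner j
    member i≢j = x∈p∧x≢y⇒x∈p-y (∈-image corner _) (i≢j ∘ corner-injective)

    descend : ∀ {i} → i ≢ j → i ≢ prev j →
      next i ≢ j × Adj H (corner i) (corner (next i)) × distance (next i) (prev j) < distance i (prev j)
    descend _ i≢prev = (λ e → i≢prev (trans (sym (prev-next _)) (cong prev e))) , rim _ ,
                       distance-next (prev j) _ i≢prev

    reach : ∀ {u} → u ∈ corners - corner j → Reach H (corners - corner j) u (corner (prev j))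
    reach u∈ with image⁻ corner (x∈p-y⇒x∈p u∈)
    ... | i , refl = reach-root H corner {J = λ i → i ≢ j} (prev j) next (λ i → distance i (prev j))
                       member descend (x∈p-y⇒x≢y u∈ ∘ cong corner)

  corners-biconnected : Biconnected H corners
  corners-biconnected = corners-connected , λ _ _ → minus-connected
    where
    minus-connected : ∀ {x} → x ∈ corners → Connected H (corners - x)
    minus-connected x∈ with image⁻ corner x∈
    ... | j , refl = corners-minus-connected j

  3≤∣corners∣ : 3 ≤ ∣ corners ∣
  3≤∣corners∣ = 3≤∣p∣ (∈-image corner 0F) (∈-image corner 1F) (∈-image corner 2F)
    ((λ ()) ∘ corner-injective) ((λ ()) ∘ corner-injective) ((λ ()) ∘ corner-injective)

  centred-hexagon⇒¬blocks-complete : ¬ LocalBlocksComplete H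
  centred-hexagon⇒¬blocks-complete blocks-complete =
    biconnected-in-ball⇒complete blocks-complete corners⊆B₂ (∈-image corner hub)
      corners-biconnected 3≤∣corners∣
      λ (T , corners⊆T , T-complete) →
        let in-T = λ i → corners⊆T (∈-image corner i) in
        non-adj⇒¬Adj H long-diagonal (CompleteBipartite-P₄ H T-complete
          (in-T 0F) (in-T 1F) (in-T 2F) (in-T 3F) (rim 0F) (rim 1F) (rim 2F))
    where
    corners⊆B₂ : corners ⊆ Ball2 H (corner hub)
    corners⊆B₂ u∈ with image⁻ corner u∈
    ... | i , refl = near-hub i

Within2 : ∀ {k} → (Fin k → Fin k → Bool) → Fin k → Fin k → Set
Within2 G h i = G h i ≡ true ⊎ ∃ λ w → G h w ≡ true × G w i ≡ true

CentredHexagonPattern : (Fin 6 → Fin 6 → Bool) → Fin 6 → Set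
CentredHexagonPattern G hub = (∀ i → G i (next i) ≡ true) × (∀ i → Within2 G hub i) × G 0F 3F ≡ false

centredHexagonPattern? : ∀ G hub → Dec (CentredHexagonPattern G hub)
centredHexagonPattern? G hub =
  all? (λ i → G i (next i) ≟ᵇ true) ×-dec
  all? (λ i → G hub i ≟ᵇ true ⊎-dec any? λ w → G hub w ≟ᵇ true ×-dec G w i ≟ᵇ true) ×-dec
  G 0F 3F ≟ᵇ false

induced-centred-hexagon : ∀ {n} (H : Graph n) G hub → CentredHexagonPattern G hub → HasInduced H G →
  CentredHexagon H
induced-centred-hexagon H G hub (rim , near , diagonal) (f , f-inj , f-adj) = record
  { corner = f
  ; corner-injective = f-inj
  ; rim = λ i → trans (f-adj i (next i)) (rim i)
  ; hub = hub
  ; near-hub = λ i → within (near i)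
  ; long-diagonal = trans (f-adj 0F 3F) diagonal
  }
  where
  within : ∀ {i} → Within2 G hub i → f i ∈ Ball2 H (f hub)
  within (inj₁ e) = Adj⇒∈Ball2 H (trans (f-adj _ _) e)
  within (inj₂ (w , e₁ , e₂)) = Adj²⇒∈Ball2 H (trans (f-adj _ w) e₁) (trans (f-adj w _) e₂)

K33-e-hexagon : Fin 6 → Fin 6
K33-e-hexagon = 0F ∷ 4F ∷ 1F ∷ 3F ∷ 2F ∷ 5F ∷ []

K33-e-hexagon-injective : ∀ i j → K33-e-hexagon i ≡ K33-e-hexagon j → i ≡ j
K33-e-hexagon-injective = toWitness {a? = injective? K33-e-hexagon} _

K33-e-centred-hexagon : CentredHexagonPattern (K33-e on K33-e-hexagon) 2F
K33-e-centred-hexagon = toWitness {a? = centredHexagonPattern? (K33-e on K33-e-hexagon) 2F} _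

Domino-hexagon : Fin 6 → Fin 6
Domino-hexagon = 0F ∷ 1F ∷ 2F ∷ 5F ∷ 4F ∷ 3F ∷ []

Domino-hexagon-injective : ∀ i j → Domino-hexagon i ≡ Domino-hexagon j → i ≡ j
Domino-hexagon-injective = toWitness {a? = injective? Domino-hexagon} _

Domino-centred-hexagon : CentredHexagonPattern (Domino on Domino-hexagon) 1F
Domino-centred-hexagon = toWitness {a? = centredHexagonPattern? (Domino on Domino-hexagon) 1F} _

blocks-complete⇒K33-e-free : ∀ {n} {H : Graph n} → LocalBlocksComplete H → ¬ HasInduced H K33-e
blocks-complete⇒K33-e-free {H = H} blocks-complete =
  (λ hexagon → centred-hexagon⇒¬blocks-complete hexagon blocks-complete)
  ∘ induced-centred-hexagon H (K33-e on K33-e-hexagon) 2F K33-e-centred-hexagon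
  ∘ HasInduced-relabel H K33-e-hexagon K33-e-hexagon-injective (λ _ _ → refl)

blocks-complete⇒domino-free : ∀ {n} {H : Graph n} → LocalBlocksComplete H → ¬ HasInduced H Domino
blocks-complete⇒domino-free {H = H} blocks-complete =
  (λ hexagon → centred-hexagon⇒¬blocks-complete hexagon blocks-complete)
  ∘ induced-centred-hexagon H (Domino on Domino-hexagon) 1F Domino-centred-hexagon
  ∘ HasInduced-relabel H Domino-hexagon Domino-hexagon-injective (λ _ _ → refl)

lemma6p3 : ∀ {n : ℕ} (H : Graph n) → Bipartite H →
    ((¬ HasInduced H K33-e × ¬ HasInduced H Domino) ⇔
     (∀ (v : Fin n) (U T : Subset n) →
        IsSplitComponent H (Ball2 H v) v U → IsBlockAt H U v T → CompleteBipartite H T))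
lemma6p3 H (_ , proper) = mk⇔
  (λ (K33-e-free , domino-free) → K33-e-domino-free⇒blocks-complete proper K33-e-free domino-free)
  (λ blocks-complete →
     blocks-complete⇒K33-e-free blocks-complete , blocks-complete⇒domino-free blocks-complete)
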